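{- Let $\mathcal G'$ be the infinite directed graph with vertex set $\{T_i, B_i : i\ge 0\}$ and the following edges: $B_i\to T_i$ for all $i\ge0$; $T_{i+1}\to B_i$ for all $i\ge0$; $T_i\to T_{i+1}$ and $B_i\to B_{i+1}$ for all $i\ge0$; and additionally $T_0\to T_j$ and $B_0\to B_j$ for all $j\ge2$ (this is the graph of $S$-Motzkin paths with catastrophes with all edges reversed). For $i\ge 0$ let $a_i(z)$ (resp. $b_i(z)$) be the generating function whose coefficient of $z^n$ is the number of directed walks with $n$ edges in $\mathcal G'$ from $T_0$ to $T_i$ (resp. to $B_i$). Let $t=t(z)$ be the unique formal power series with $t(0)=0$ and $t(1-t)^2=z^3$. Then $$b_0=\frac{t(1-t)}{ -t+z-2zt+zt^2},\qquad a_0=\frac{ -t+z-zt}{ -t+z-2zt+zt^2}.$$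
   Context: Walks in $\mathcal G'$ encode $S$-Motzkin paths with catastrophes read from right to left. -}

module Defs where

open import Data.Nat using (ℕ; zero; suc)
open import Data.Integer using (ℤ; +_; -_) renaming (_+_ to _+ℤ_; _*_ to _*ℤ_)
open import Data.Fin using (Fin)
open import Function.Bundles using (_↔_)
open import Relation.Binary.PropositionalEquality using (_≡_)

data Vertex : Set where
  T : ℕ → Vertex
  B : ℕ → Vertex

data Edge : Vertex → Vertex → Set where
  B→T   : ∀ i → Edge (B i) (T i)
  T→B   : ∀ i → Edge (T (suc i)) (B i)
  T→T   : ∀ i → Edge (T i) (T (suc i))
  B→B   : ∀ i → Edge (B i) (B (suc i))
  T₀→T  : ∀ j → Edge (T 0) (T (suc (suc j)))
  B₀→B  : ∀ j → Edge (B 0) (B (suc (suc j)))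

data Walk : Vertex → Vertex → ℕ → Set where
  []  : ∀ {u} → Walk u u 0
  _∷_ : ∀ {u w v n} → Edge u w → Walk w v n → Walk u v (suc n)

CountsWalks : Vertex → Vertex → (ℕ → ℕ) → Set
CountsWalks u v c = ∀ n → Walk u v n ↔ Fin (c n)

PS : Set
PS = ℕ → ℤ

_≈_ : PS → PS → Set
f ≈ g = ∀ n → f n ≡ g n

infix 4 _≈_
infixl 6 _⊕_ _⊖_
infixl 7 _⊛_

_⊕_ : PS → PS → PS
(f ⊕ g) n = f n +ℤ g n

⊝_ : PS → PS
(⊝ f) n = - f n

_⊖_ : PS → PS → PS
f ⊖ g = f ⊕ (⊝ g)

const : ℤ → PS
const c zero    = c
const c (suc n) = + 0

one : PS
one = const (+ 1)

zs : PS
zs zero          = + 0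
zs (suc zero)    = + 1
zs (suc (suc n)) = + 0

-- Cauchy product: (f ⊛ g) n = Σ_{k=0}^{n} f k * g (n - k)
conv : (ℕ → ℤ) → (ℕ → ℤ) → ℕ → ℤ
conv f g zero    = f 0 *ℤ g 0
conv f g (suc n) = f 0 *ℤ g (suc n) +ℤ conv (λ k → f (suc k)) g n

_⊛_ : PS → PS → PS
(f ⊛ g) n = conv f g n

fromℕ : (ℕ → ℕ) → PS
fromℕ c n = + (c n)

module Submission where

-- Give T_i height 2i and B_i height 2i + 1. Away from heights 0 and 1 every edge of G' is a step −1 or +2, so a walk
-- from height h + 1 to T₀ or B₀ first reaches B₀ along a path counted by D^h, where D = z(1 + D³) counts first
-- descents by one level. Let a and b be the series of walks from T₀ and from B₀, and A = Σ_{j≥0} D^{2j+1} b the sum of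
-- the series of walks from T_j, j ≥ 1. The catastrophe edges give a = c₀ + zA and b = c₁ + z(a + DA), where c₀, c₁
-- mark the target, and eliminating A gives (1 − D² − zD² − z²D) a = (1 − D² − zD²) c₀ + zD c₁. Finally t = zD² is the
-- only solution of t(1 − t)² = z³ with t(0) = 0, and z(1 − D² − zD² − z²D) is the stated denominator.

open import Defs
open import Data.Nat using (ℕ; zero; suc; _∸_; _≤_; _<_; z≤n; s≤s) renaming (_+_ to _+ℕ_)
import Data.Nat.Properties as ℕ
open import Data.Integer using (ℤ; +_; -_) renaming (_+_ to _+ℤ_; _*_ to _*ℤ_)
import Data.Integer.Properties as ℤ
open import Data.Integer.Tactic.RingSolver using (solve-∀)
open import Data.Fin using (Fin)
import Data.Fin as Fin
open import Data.Fin.Properties using (+↔⊎)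
open import Data.Fin.Permutation using (↔⇒≡)
open import Data.Sum using (_⊎_; inj₁; inj₂)
open import Data.Sum.Function.Propositional using (_⊎-↔_)
open import Data.Product using (Σ; _×_; _,_)
open import Data.Maybe using (Maybe; just; nothing)
open import Data.Empty using (⊥-elim)
open import Function.Bundles using (_↔_; mk↔ₛ′; Inverse)
open import Function.Base using (_∘′_)
open import Function.Properties.Inverse using (↔-trans; ↔-sym)
open import Relation.Nullary using (¬_; Dec; yes; no)
open import Relation.Binary.PropositionalEquality
open import Relation.Binary.Bundles using (Setoid)
import Relation.Binary.Reasoning.Setoid
open import Relation.Binary.Structures using (IsEquivalence)
open import Algebra.Bundles using (CommutativeRing; RawRing)
open import Algebra.Structures using (IsCommutativeRing)
open import Level using (0ℓ)
import Algebra.Solver.Ring.AlmostCommutativeRing as ACR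

shift : PS → PS
shift f k = f (suc k)

conv-cong : ∀ {f f′ g g′} → f ≈ f′ → g ≈ g′ → ∀ n → conv f g n ≡ conv f′ g′ n
conv-cong f≈ g≈ zero    = cong₂ _*ℤ_ (f≈ 0) (g≈ 0)
conv-cong f≈ g≈ (suc n) = cong₂ _+ℤ_ (cong₂ _*ℤ_ (f≈ 0) (g≈ (suc n))) (conv-cong (λ k → f≈ (suc k)) g≈ n)

conv-zeroˡ : ∀ f g → (∀ k → f k ≡ + 0) → ∀ n → conv f g n ≡ + 0
conv-zeroˡ f g f≡0 zero    rewrite f≡0 0 = refl
conv-zeroˡ f g f≡0 (suc n) rewrite f≡0 0 | conv-zeroˡ (shift f) g (λ k → f≡0 (suc k)) n = refl

conv-distribʳ : ∀ f f′ g n → conv (f ⊕ f′) g n ≡ conv f g n +ℤ conv f′ g n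
conv-distribʳ f f′ g zero    = ℤ.*-distribʳ-+ (g 0) (f 0) (f′ 0)
conv-distribʳ f f′ g (suc n) rewrite conv-distribʳ (shift f) (shift f′) g n =
  interchange (f 0) (f′ 0) (g (suc n)) _ _
  where
  interchange : ∀ a b c x y → (a +ℤ b) *ℤ c +ℤ (x +ℤ y) ≡ (a *ℤ c +ℤ x) +ℤ (b *ℤ c +ℤ y)
  interchange = solve-∀

conv-distribˡ : ∀ f g g′ n → conv f (g ⊕ g′) n ≡ conv f g n +ℤ conv f g′ n
conv-distribˡ f g g′ zero    = ℤ.*-distribˡ-+ (f 0) (g 0) (g′ 0)
conv-distribˡ f g g′ (suc n) rewrite conv-distribˡ (shift f) g g′ n =
  interchange (f 0) (g (suc n)) (g′ (suc n)) _ _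
  where
  interchange : ∀ a b c x y → a *ℤ (b +ℤ c) +ℤ (x +ℤ y) ≡ (a *ℤ b +ℤ x) +ℤ (a *ℤ c +ℤ y)
  interchange = solve-∀

conv-scaleˡ : ∀ c f g n → conv (λ k → c *ℤ f k) g n ≡ c *ℤ conv f g n
conv-scaleˡ c f g zero    = ℤ.*-assoc c (f 0) (g 0)
conv-scaleˡ c f g (suc n) rewrite conv-scaleˡ c (shift f) g n = factor c (f 0) (g (suc n)) _
  where
  factor : ∀ c a b x → (c *ℤ a) *ℤ b +ℤ c *ℤ x ≡ c *ℤ (a *ℤ b +ℤ x)
  factor = solve-∀

conv-sucʳ : ∀ f g n → conv f g (suc n) ≡ conv f (shift g) n +ℤ f (suc n) *ℤ g 0
conv-sucʳ f g zero    = refl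
conv-sucʳ f g (suc n) rewrite conv-sucʳ (shift f) g n =
  sym (ℤ.+-assoc (f 0 *ℤ g (suc (suc n))) (conv (shift f) (shift g) n) (f (suc (suc n)) *ℤ g 0))

conv-comm : ∀ f g n → conv f g n ≡ conv g f n
conv-comm f g zero    = ℤ.*-comm (f 0) (g 0)
conv-comm f g (suc n) rewrite conv-comm (shift f) g n | conv-sucʳ g f n = swap (f 0) (g (suc n)) _
  where
  swap : ∀ a b x → a *ℤ b +ℤ x ≡ x +ℤ b *ℤ a
  swap = solve-∀

conv-assoc : ∀ f g h n → conv (f ⊛ g) h n ≡ conv f (g ⊛ h) n
conv-assoc f g h zero    = ℤ.*-assoc (f 0) (g 0) (h 0)
conv-assoc f g h (suc n)
  rewrite conv-distribʳ (λ k → f 0 *ℤ g (suc k)) (shift f ⊛ g) h n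
        | conv-scaleˡ (f 0) (shift g) h n
        | conv-assoc (shift f) g h n
  = regroup (f 0) (g 0) (h (suc n)) _ _
  where
  regroup : ∀ a b c y z → a *ℤ b *ℤ c +ℤ (a *ℤ y +ℤ z) ≡ a *ℤ (b *ℤ c +ℤ y) +ℤ z
  regroup = solve-∀

conv-constˡ : ∀ c f n → conv (const c) f n ≡ c *ℤ f n
conv-constˡ c f zero    = refl
conv-constˡ c f (suc n) rewrite conv-zeroˡ (shift (const c)) f (λ _ → refl) n = ℤ.+-identityʳ _

0ₚ : PS
0ₚ = const (+ 0)

≈-isEquivalence : IsEquivalence _≈_
≈-isEquivalence = record
  { refl  = λ _ → refl
  ; sym   = λ f≈g n → sym (f≈g n)
  ; trans = λ f≈g g≈h n → trans (f≈g n) (g≈h n)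
  }

PS-setoid : Setoid 0ℓ 0ℓ
PS-setoid = record { isEquivalence = ≈-isEquivalence }

open Setoid PS-setoid using () renaming (refl to ≈-refl; sym to ≈-sym; trans to ≈-trans)

const-zero : ∀ n → const (+ 0) n ≡ + 0
const-zero zero    = refl
const-zero (suc n) = refl

⊕-cong : ∀ {f f′ g g′} → f ≈ f′ → g ≈ g′ → f ⊕ g ≈ f′ ⊕ g′
⊕-cong f≈ g≈ n = cong₂ _+ℤ_ (f≈ n) (g≈ n)

⊝-cong : ∀ {f g} → f ≈ g → ⊝ f ≈ ⊝ g
⊝-cong f≈g n = cong -_ (f≈g n)

⊛-cong : ∀ {f f′ g g′} → f ≈ f′ → g ≈ g′ → f ⊛ g ≈ f′ ⊛ g′
⊛-cong = conv-cong

⊕-congˡ : ∀ h {f g} → f ≈ g → h ⊕ f ≈ h ⊕ g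
⊕-congˡ h f≈g n = cong (h n +ℤ_) (f≈g n)

⊕-congʳ : ∀ h {f g} → f ≈ g → f ⊕ h ≈ g ⊕ h
⊕-congʳ h f≈g n = cong (_+ℤ h n) (f≈g n)

⊖-congʳ : ∀ h {f g} → f ≈ g → f ⊖ h ≈ g ⊖ h
⊖-congʳ h = ⊕-congʳ (⊝ h)

⊛-congˡ : ∀ h {f g} → f ≈ g → h ⊛ f ≈ h ⊛ g
⊛-congˡ h f≈g = conv-cong ≈-refl f≈g

⊛-congʳ : ∀ h {f g} → f ≈ g → f ⊛ h ≈ g ⊛ h
⊛-congʳ h f≈g = conv-cong f≈g ≈-refl

PS-isCommutativeRing : IsCommutativeRing _≈_ _⊕_ _⊛_ ⊝_ 0ₚ one
PS-isCommutativeRing = record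
  { isRing = record
    { +-isAbelianGroup = record
      { isGroup = record
        { isMonoid = record
          { isSemigroup = record
            { isMagma = record
              { isEquivalence = ≈-isEquivalence
              ; ∙-cong = ⊕-cong }
            ; assoc = λ f g h n → ℤ.+-assoc (f n) (g n) (h n) }
          ; identity = (λ f n → trans (cong (_+ℤ f n) (const-zero n)) (ℤ.+-identityˡ (f n)))
                     , (λ f n → trans (cong (f n +ℤ_) (const-zero n)) (ℤ.+-identityʳ (f n))) }
        ; inverse = (λ f n → trans (ℤ.+-inverseˡ (f n)) (sym (const-zero n)))
                  , (λ f n → trans (ℤ.+-inverseʳ (f n)) (sym (const-zero n)))
        ; ⁻¹-cong = ⊝-cong }
      ; comm = λ f g n → ℤ.+-comm (f n) (g n) }
    ; *-cong = ⊛-cong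
    ; *-assoc = conv-assoc
    ; *-identity = (λ f n → trans (conv-constˡ (+ 1) f n) (ℤ.*-identityˡ (f n)))
                 , (λ f n → trans (conv-comm f one n) (trans (conv-constˡ (+ 1) f n) (ℤ.*-identityˡ (f n))))
    ; distrib = conv-distribˡ , λ h f g → conv-distribʳ f g h }
  ; *-comm = conv-comm }

PS-commutativeRing : CommutativeRing 0ℓ 0ℓ
PS-commutativeRing = record { isCommutativeRing = PS-isCommutativeRing }

PS-almostCommutativeRing : ACR.AlmostCommutativeRing 0ℓ 0ℓ
PS-almostCommutativeRing = ACR.fromCommutativeRing PS-commutativeRing

ℤ-rawRing : RawRing 0ℓ 0ℓ
ℤ-rawRing = CommutativeRing.rawRing ℤ.+-*-commutativeRing

const-homomorphism : ℤ-rawRing ACR.-Raw-AlmostCommutative⟶ PS-almostCommutativeRing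
const-homomorphism = record
  { ⟦_⟧    = const
  ; +-homo = λ { a b zero → refl ; a b (suc n) → refl }
  ; *-homo = λ a b n → sym (trans (conv-constˡ a (const b) n) (scale-const a b n))
  ; -‿homo = λ { a zero → refl ; a (suc n) → refl }
  ; 0-homo = ≈-refl
  ; 1-homo = λ n → refl
  }
  where
  scale-const : ∀ a b n → a *ℤ const b n ≡ const (a *ℤ b) n
  scale-const a b zero    = refl
  scale-const a b (suc n) = ℤ.*-zeroʳ a

const-≟ : ∀ a b → Maybe (const a ≈ const b)
const-≟ a b with a ℤ.≟ b
... | yes refl = just ≈-refl
... | no _     = nothing

open import Algebra.Solver.Ring ℤ-rawRing PS-almostCommutativeRing const-homomorphism const-≟
  using (solve; _:+_; _:-_; _:*_; con; _:=_)

open import Algebra.Properties.Group (CommutativeRing.+-group PS-commutativeRing)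
  using (x∙y⁻¹≈ε⇒x≈y; x≈y⇒x∙y⁻¹≈ε)

module ≈-Reasoning = Relation.Binary.Reasoning.Setoid PS-setoid

zs-shift : ∀ f n → (zs ⊛ f) (suc n) ≡ f n
zs-shift f n = trans (ℤ.+-identityˡ _) (trans (conv-cong shift-zs ≈-refl n) (trans (conv-constˡ (+ 1) f n) (ℤ.*-identityˡ (f n))))
  where
  shift-zs : shift zs ≈ one
  shift-zs zero    = refl
  shift-zs (suc k) = refl

conv-cong-≤ : ∀ f g g′ n → (∀ k → k ≤ n → g k ≡ g′ k) → conv f g n ≡ conv f g′ n
conv-cong-≤ f g g′ zero    g≡ = cong (f 0 *ℤ_) (g≡ 0 z≤n)
conv-cong-≤ f g g′ (suc n) g≡ = cong₂ _+ℤ_ (cong (f 0 *ℤ_) (g≡ (suc n) ℕ.≤-refl))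
  (conv-cong-≤ (shift f) g g′ n (λ k k≤n → g≡ k (ℕ.m≤n⇒m≤1+n k≤n)))

conv-vanishˡ : ∀ f g n → (∀ k → k ≤ n → f k ≡ + 0) → conv f g n ≡ + 0
conv-vanishˡ f g n f≡0 = begin
  conv f g n           ≡⟨ conv-comm f g n ⟩
  conv g f n           ≡⟨ conv-cong-≤ g f (λ _ → + 0) n f≡0 ⟩
  conv g (λ _ → + 0) n ≡⟨ conv-comm g _ n ⟩
  conv (λ _ → + 0) g n ≡⟨ conv-zeroˡ _ g (λ _ → refl) n ⟩
  + 0                  ∎
  where open ≡-Reasoning

⊛-noZeroDivisorˡ : ∀ {u f} → u 0 ≡ + 1 → u ⊛ f ≈ 0ₚ → f ≈ 0ₚ
⊛-noZeroDivisorˡ {u} {f} u₀≡1 uf≈0 n = trans (vanishes n n ℕ.≤-refl) (sym (const-zero n))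
  where
  leading : ∀ n → conv f (shift u) n ≡ + 0 → f (suc n) ≡ + 0
  leading n rest≡0 = begin
    f (suc n)                                  ≡⟨ sym (ℤ.*-identityʳ (f (suc n))) ⟩
    f (suc n) *ℤ + 1                           ≡⟨ cong (f (suc n) *ℤ_) (sym u₀≡1) ⟩
    f (suc n) *ℤ u 0                           ≡⟨ sym (ℤ.+-identityˡ _) ⟩
    + 0 +ℤ f (suc n) *ℤ u 0                    ≡⟨ cong (_+ℤ f (suc n) *ℤ u 0) (sym rest≡0) ⟩
    conv f (shift u) n +ℤ f (suc n) *ℤ u 0     ≡⟨ sym (conv-sucʳ f u n) ⟩
    conv f u (suc n)                           ≡⟨ conv-comm f u (suc n) ⟩
    conv u f (suc n)                           ≡⟨ uf≈0 (suc n) ⟩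
    + 0                                        ∎
    where open ≡-Reasoning

  vanishes : ∀ n k → k ≤ n → f k ≡ + 0
  vanishes zero .zero z≤n = begin
    f 0            ≡⟨ sym (ℤ.*-identityʳ (f 0)) ⟩
    f 0 *ℤ + 1     ≡⟨ cong (f 0 *ℤ_) (sym u₀≡1) ⟩
    f 0 *ℤ u 0     ≡⟨ ℤ.*-comm (f 0) (u 0) ⟩
    u 0 *ℤ f 0     ≡⟨ uf≈0 0 ⟩
    + 0            ∎
    where open ≡-Reasoning
  vanishes (suc n) k k≤1+n with ℕ.m≤n⇒m<n∨m≡n k≤1+n
  ... | inj₁ (s≤s k≤n) = vanishes n k k≤n
  ... | inj₂ refl      = leading n (conv-vanishˡ f (shift u) n (vanishes n))

⊛-cancelˡ : ∀ {u f g} → u 0 ≡ + 1 → u ⊛ f ≈ u ⊛ g → f ≈ g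
⊛-cancelˡ {u} {f} {g} u₀≡1 uf≈ug = x∙y⁻¹≈ε⇒x≈y f g (⊛-noZeroDivisorˡ u₀≡1 (begin
  u ⊛ (f ⊖ g)       ≈⟨ solve 3 (λ u f g → u :* (f :- g) := u :* f :- u :* g) ≈-refl u f g ⟩
  u ⊛ f ⊖ u ⊛ g     ≈⟨ x≈y⇒x∙y⁻¹≈ε uf≈ug ⟩
  0ₚ                ∎))
  where open ≈-Reasoning

by-first-step : ∀ {f g} c → f 0 ≡ c → (∀ n → f (suc n) ≡ g n) → f ≈ const c ⊕ zs ⊛ g
by-first-step {g = g} c f₀≡c f-suc zero    = trans f₀≡c (sym (trans (cong (c +ℤ_) (ℤ.*-zeroˡ (g 0))) (ℤ.+-identityʳ c)))
by-first-step {g = g} c f₀≡c f-suc (suc n) = trans (f-suc n) (sym (trans (ℤ.+-identityˡ _) (zs-shift g n)))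

sumℕ : ℕ → (ℕ → ℕ) → ℕ
sumℕ zero    c = 0
sumℕ (suc N) c = c 0 +ℕ sumℕ N (λ j → c (suc j))

sumℤ : ℕ → (ℕ → ℤ) → ℤ
sumℤ zero    c = + 0
sumℤ (suc N) c = c 0 +ℤ sumℤ N (λ j → c (suc j))

+-sumℕ : ∀ N c → + sumℕ N c ≡ sumℤ N (λ j → + c j)
+-sumℕ zero    c = refl
+-sumℕ (suc N) c = trans (ℤ.pos-+ (c 0) _) (cong (+ c 0 +ℤ_) (+-sumℕ N (λ j → c (suc j))))

sumℤ-cong : ∀ N {c c′} → (∀ j → c j ≡ c′ j) → sumℤ N c ≡ sumℤ N c′
sumℤ-cong zero    c≡ = refl
sumℤ-cong (suc N) c≡ = cong₂ _+ℤ_ (c≡ 0) (sumℤ-cong N (λ j → c≡ (suc j)))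

sumℤ-suc : ∀ N c → sumℤ (suc N) c ≡ sumℤ N c +ℤ c N
sumℤ-suc zero    c = trans (ℤ.+-identityʳ (c 0)) (sym (ℤ.+-identityˡ (c 0)))
sumℤ-suc (suc N) c = trans (cong (c 0 +ℤ_) (sumℤ-suc N (λ j → c (suc j)))) (sym (ℤ.+-assoc (c 0) _ _))

sumℤ-vanishing-tail : ∀ N d c → (∀ j → N ≤ j → c j ≡ + 0) → sumℤ (N +ℕ d) c ≡ sumℤ N c
sumℤ-vanishing-tail N zero    c tail≡0 = cong (λ M → sumℤ M c) (ℕ.+-identityʳ N)
sumℤ-vanishing-tail N (suc d) c tail≡0 = begin
  sumℤ (N +ℕ suc d) c                ≡⟨ cong (λ M → sumℤ M c) (ℕ.+-suc N d) ⟩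
  sumℤ (suc (N +ℕ d)) c              ≡⟨ sumℤ-suc (N +ℕ d) c ⟩
  sumℤ (N +ℕ d) c +ℤ c (N +ℕ d)      ≡⟨ cong₂ _+ℤ_ (sumℤ-vanishing-tail N d c tail≡0) (tail≡0 (N +ℕ d) (ℕ.m≤m+n N d)) ⟩
  sumℤ N c +ℤ + 0                    ≡⟨ ℤ.+-identityʳ _ ⟩
  sumℤ N c                           ∎
  where open ≡-Reasoning

-- The j-th member of a summable family has order at least j, so the n-th coefficient of its sum is a finite sum over j ≤ n.
Summable : (ℕ → PS) → Set
Summable F = ∀ j m → m < j → F j m ≡ + 0

Σ∞ : (ℕ → PS) → PS
Σ∞ F n = sumℤ (suc n) (λ j → F j n)

Σ∞-cong : ∀ {F G} → (∀ j → F j ≈ G j) → Σ∞ F ≈ Σ∞ G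
Σ∞-cong F≈G n = sumℤ-cong (suc n) (λ j → F≈G j n)

Σ∞-split : ∀ F → Summable F → Σ∞ F ≈ F 0 ⊕ Σ∞ (λ j → F (suc j))
Σ∞-split F summable n = cong (F 0 n +ℤ_) (begin
  sumℤ n (λ j → F (suc j) n)                          ≡⟨ sym (ℤ.+-identityʳ _) ⟩
  sumℤ n (λ j → F (suc j) n) +ℤ + 0                   ≡⟨ cong (sumℤ n (λ j → F (suc j) n) +ℤ_) (sym (summable (suc n) n ℕ.≤-refl)) ⟩
  sumℤ n (λ j → F (suc j) n) +ℤ F (suc n) n           ≡⟨ sym (sumℤ-suc n (λ j → F (suc j) n)) ⟩
  sumℤ (suc n) (λ j → F (suc j) n)                    ∎)
  where open ≡-Reasoning

Σ∞-⊛ : ∀ g F → Summable F → g ⊛ Σ∞ F ≈ Σ∞ (λ j → g ⊛ F j)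
Σ∞-⊛ g F summable n = trans (conv-cong-≤ g (Σ∞ F) (partial (suc n) F) n truncate) (conv-partial (suc n) F)
  where
  partial : ℕ → (ℕ → PS) → PS
  partial N F m = sumℤ N (λ j → F j m)

  truncate : ∀ k → k ≤ n → Σ∞ F k ≡ partial (suc n) F k
  truncate k k≤n = begin
    sumℤ (suc k) (λ j → F j k)                ≡⟨ sym (sumℤ-vanishing-tail (suc k) (n ∸ k) (λ j → F j k) (λ j → summable j k)) ⟩
    sumℤ (suc k +ℕ (n ∸ k)) (λ j → F j k)     ≡⟨ cong (λ M → sumℤ (suc M) (λ j → F j k)) (ℕ.m+[n∸m]≡n k≤n) ⟩
    sumℤ (suc n) (λ j → F j k)                ∎
    where open ≡-Reasoning

  conv-partial : ∀ N F → conv g (partial N F) n ≡ sumℤ N (λ j → conv g (F j) n)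
  conv-partial zero    F = trans (conv-comm g _ n) (conv-zeroˡ _ g (λ _ → refl) n)
  conv-partial (suc N) F = trans (conv-distribˡ g (F 0) (partial N (λ j → F (suc j))) n)
                                 (cong (conv g (F 0) n +ℤ_) (conv-partial N (λ j → F (suc j))))

-- firstPassage k counts the paths with steps −1 and +2 from height k that reach height 0 for the first time at their last step.
firstPassage : ℕ → PS
firstPassage zero    zero    = + 1
firstPassage zero    (suc n) = + 0
firstPassage (suc k) zero    = + 0
firstPassage (suc k) (suc n) = firstPassage k n +ℤ firstPassage (3 +ℕ k) n

firstPassage-zero : firstPassage 0 ≈ one
firstPassage-zero zero    = refl
firstPassage-zero (suc n) = refl

firstPassage-suc : ∀ k → firstPassage (suc k) ≈ zs ⊛ (firstPassage k ⊕ firstPassage (3 +ℕ k))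
firstPassage-suc k zero    = sym (ℤ.*-zeroˡ (firstPassage k 0 +ℤ firstPassage (3 +ℕ k) 0))
firstPassage-suc k (suc n) = sym (zs-shift (firstPassage k ⊕ firstPassage (3 +ℕ k)) n)

conv-firstPassage-suc : ∀ k g m →
  conv (firstPassage (suc k)) g (suc m) ≡ conv (firstPassage k) g m +ℤ conv (firstPassage (3 +ℕ k)) g m
conv-firstPassage-suc k g m = begin
  conv (firstPassage (suc k)) g (suc m)  ≡⟨ conv-cong (firstPassage-suc k) ≈-refl (suc m) ⟩
  conv (zs ⊛ F) g (suc m)                ≡⟨ conv-assoc zs F g (suc m) ⟩
  conv zs (F ⊛ g) (suc m)                ≡⟨ zs-shift (F ⊛ g) m ⟩
  conv F g m                             ≡⟨ conv-distribʳ (firstPassage k) (firstPassage (3 +ℕ k)) g m ⟩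
  conv (firstPassage k) g m +ℤ conv (firstPassage (3 +ℕ k)) g m ∎
  where
  open ≡-Reasoning
  F = firstPassage k ⊕ firstPassage (3 +ℕ k)

-- Anything obeying the path recursion at every positive height factors through the first visit to height 0.
firstPassage-decomposition : (Y : ℕ → PS) → (∀ h → Y (suc h) 0 ≡ + 0) →
  (∀ h m → Y (suc h) (suc m) ≡ Y h m +ℤ Y (3 +ℕ h) m) → ∀ h → Y h ≈ firstPassage h ⊛ Y 0
firstPassage-decomposition Y Y₀≡0 Y-step h n = decompose n h
  where
  decompose : ∀ n h → Y h n ≡ conv (firstPassage h) (Y 0) n
  decompose n       zero    = sym (trans (conv-cong firstPassage-zero ≈-refl n)
                                         (trans (conv-constˡ (+ 1) (Y 0) n) (ℤ.*-identityˡ (Y 0 n))))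
  decompose zero    (suc h) = trans (Y₀≡0 h) (sym (ℤ.*-zeroˡ (Y 0 0)))
  decompose (suc m) (suc h) = begin
    Y (suc h) (suc m)                                    ≡⟨ Y-step h m ⟩
    Y h m +ℤ Y (3 +ℕ h) m                                ≡⟨ cong₂ _+ℤ_ (decompose m h) (decompose m (3 +ℕ h)) ⟩
    conv (firstPassage h) (Y 0) m +ℤ conv (firstPassage (3 +ℕ h)) (Y 0) m ≡⟨ sym (conv-firstPassage-suc h (Y 0) m) ⟩
    conv (firstPassage (suc h)) (Y 0) (suc m)            ∎
    where open ≡-Reasoning

firstPassage-+ : ∀ j k → firstPassage (j +ℕ k) ≈ firstPassage j ⊛ firstPassage k
firstPassage-+ j k = firstPassage-decomposition (λ h → firstPassage (h +ℕ k)) (λ _ → refl) (λ _ _ → refl) j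

D : PS
D = firstPassage 1

D-equation : D ≈ zs ⊛ (one ⊕ D ⊛ D ⊛ D)
D-equation = ≈-trans (firstPassage-suc 0) (⊛-congˡ zs (⊕-cong firstPassage-zero D³))
  where
  D³ : firstPassage 3 ≈ D ⊛ D ⊛ D
  D³ = ≈-trans (firstPassage-+ 2 1) (⊛-congʳ D (firstPassage-+ 1 1))

_≟ᵥ_ : (u w : Vertex) → Dec (u ≡ w)
T i ≟ᵥ T j with i ℕ.≟ j
... | yes refl = yes refl
... | no i≢j   = no (λ { refl → i≢j refl })
T i ≟ᵥ B j = no (λ ())
B i ≟ᵥ T j = no (λ ())
B i ≟ᵥ B j with i ℕ.≟ j
... | yes refl = yes refl
... | no i≢j   = no (λ { refl → i≢j refl })

δ : Vertex → Vertex → ℕ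
δ u v with u ≟ᵥ v
... | yes _ = 1
... | no _  = 0

-- Only the first n + 1 catastrophe edges can start a walk of length n + 1 to a target of height ≤ 1:
-- from T_j and B_j at least 2j − 1 more steps are needed.
walks : Vertex → Vertex → ℕ → ℕ
walks u           v zero    = δ u v
walks (T zero)    v (suc n) = walks (T 1) v n +ℕ sumℕ (suc n) (λ j → walks (T (suc (suc j))) v n)
walks (T (suc i)) v (suc n) = walks (B i) v n +ℕ walks (T (suc (suc i))) v n
walks (B zero)    v (suc n) = walks (T 0) v n +ℕ (walks (B 1) v n +ℕ sumℕ (suc n) (λ j → walks (B (suc (suc j))) v n))
walks (B (suc i)) v (suc n) = walks (T (suc i)) v n +ℕ walks (B (suc (suc i))) v n

height : Vertex → ℕ
height (T i) = i +ℕ i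
height (B i) = suc (i +ℕ i)

edge-height : ∀ {u w} → Edge u w → height u ≤ suc (height w)
edge-height (B→T i)  = ℕ.≤-refl
edge-height (T→B i)  = s≤s (ℕ.≤-reflexive (ℕ.+-suc i i))
edge-height (T→T i)  = ℕ.m≤n⇒m≤1+n (ℕ.+-mono-≤ (ℕ.n≤1+n i) (ℕ.n≤1+n i))
edge-height (B→B i)  = s≤s (ℕ.m≤n⇒m≤1+n (ℕ.+-mono-≤ (ℕ.n≤1+n i) (ℕ.n≤1+n i)))
edge-height (T₀→T j) = z≤n
edge-height (B₀→B j) = s≤s z≤n

walk-height : ∀ {u v n} → Walk u v n → height u ≤ n +ℕ height v
walk-height []      = ℕ.≤-refl
walk-height (e ∷ w) = ℕ.≤-trans (edge-height e) (s≤s (walk-height w))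

unreachable : ∀ {u v n} → height v ≤ 1 → suc n < height u → ¬ Walk u v n
unreachable {n = n} v-low n+1<h w = ℕ.<⇒≱ n+1<h (begin
  _                ≤⟨ walk-height w ⟩
  n +ℕ _           ≤⟨ ℕ.+-monoʳ-≤ n v-low ⟩
  n +ℕ 1           ≡⟨ ℕ.+-comm n 1 ⟩
  suc n            ∎)
  where open ℕ.≤-Reasoning

beyond-catastrophe : ∀ n j → suc n < height (T (suc (suc (suc n +ℕ j))))
beyond-catastrophe n j = ℕ.≤-trans (s≤s (s≤s (ℕ.m≤n⇒m≤1+n (ℕ.m≤m+n n j)))) (ℕ.m≤m+n _ _)

Σ-split : (P : ℕ → Set) → Σ ℕ P ↔ (P 0 ⊎ Σ ℕ (λ j → P (suc j)))
Σ-split P = mk↔ₛ′ to from (λ { (inj₁ x) → refl ; (inj₂ (j , x)) → refl })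
                          (λ { (zero , x) → refl ; (suc j , x) → refl })
  where
  to : Σ ℕ P → P 0 ⊎ Σ ℕ (λ j → P (suc j))
  to (zero  , x) = inj₁ x
  to (suc j , x) = inj₂ (j , x)
  from : P 0 ⊎ Σ ℕ (λ j → P (suc j)) → Σ ℕ P
  from (inj₁ x)       = 0 , x
  from (inj₂ (j , x)) = suc j , x

Σ-↔-sumℕ : (P : ℕ → Set) (c : ℕ → ℕ) → (∀ j → P j ↔ Fin (c j)) → (N : ℕ) → (∀ j → ¬ P (N +ℕ j)) →
           Σ ℕ P ↔ Fin (sumℕ N c)
Σ-↔-sumℕ P c P↔ zero    empty = mk↔ₛ′ (λ { (j , x) → ⊥-elim (empty j x) }) (λ ()) (λ ())
                                        (λ { (j , x) → ⊥-elim (empty j x) })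
Σ-↔-sumℕ P c P↔ (suc N) empty =
  ↔-trans (Σ-split P) (↔-trans (P↔ 0 ⊎-↔ Σ-↔-sumℕ _ _ (λ j → P↔ (suc j)) N empty) (↔-sym +↔⊎))

module _ {v : Vertex} where

  walk-T₀ : ∀ n → Walk (T 0) v (suc n) ↔ (Walk (T 1) v n ⊎ Σ ℕ (λ j → Walk (T (suc (suc j))) v n))
  walk-T₀ n = mk↔ₛ′ to from (λ { (inj₁ w) → refl ; (inj₂ (j , w)) → refl })
                            (λ { (T→T .0 ∷ w) → refl ; (T₀→T j ∷ w) → refl })
    where
    to : Walk (T 0) v (suc n) → Walk (T 1) v n ⊎ Σ ℕ (λ j → Walk (T (suc (suc j))) v n)
    to (T→T .0 ∷ w) = inj₁ w
    to (T₀→T j ∷ w) = inj₂ (j , w)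
    from : Walk (T 1) v n ⊎ Σ ℕ (λ j → Walk (T (suc (suc j))) v n) → Walk (T 0) v (suc n)
    from (inj₁ w)       = T→T 0 ∷ w
    from (inj₂ (j , w)) = T₀→T j ∷ w

  walk-T : ∀ n i → Walk (T (suc i)) v (suc n) ↔ (Walk (B i) v n ⊎ Walk (T (suc (suc i))) v n)
  walk-T n i = mk↔ₛ′ to from (λ { (inj₁ w) → refl ; (inj₂ w) → refl })
                             (λ { (T→B .i ∷ w) → refl ; (T→T .(suc i) ∷ w) → refl })
    where
    to : Walk (T (suc i)) v (suc n) → Walk (B i) v n ⊎ Walk (T (suc (suc i))) v n
    to (T→B .i ∷ w)       = inj₁ w
    to (T→T .(suc i) ∷ w) = inj₂ w
    from : Walk (B i) v n ⊎ Walk (T (suc (suc i))) v n → Walk (T (suc i)) v (suc n)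
    from (inj₁ w) = T→B i ∷ w
    from (inj₂ w) = T→T (suc i) ∷ w

  walk-B₀ : ∀ n → Walk (B 0) v (suc n) ↔
                  (Walk (T 0) v n ⊎ (Walk (B 1) v n ⊎ Σ ℕ (λ j → Walk (B (suc (suc j))) v n)))
  walk-B₀ n = mk↔ₛ′ to from (λ { (inj₁ w) → refl ; (inj₂ (inj₁ w)) → refl ; (inj₂ (inj₂ (j , w))) → refl })
                            (λ { (B→T .0 ∷ w) → refl ; (B→B .0 ∷ w) → refl ; (B₀→B j ∷ w) → refl })
    where
    to : Walk (B 0) v (suc n) → Walk (T 0) v n ⊎ (Walk (B 1) v n ⊎ Σ ℕ (λ j → Walk (B (suc (suc j))) v n))
    to (B→T .0 ∷ w) = inj₁ w
    to (B→B .0 ∷ w) = inj₂ (inj₁ w)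
    to (B₀→B j ∷ w) = inj₂ (inj₂ (j , w))
    from : Walk (T 0) v n ⊎ (Walk (B 1) v n ⊎ Σ ℕ (λ j → Walk (B (suc (suc j))) v n)) → Walk (B 0) v (suc n)
    from (inj₁ w)              = B→T 0 ∷ w
    from (inj₂ (inj₁ w))       = B→B 0 ∷ w
    from (inj₂ (inj₂ (j , w))) = B₀→B j ∷ w

  walk-B : ∀ n i → Walk (B (suc i)) v (suc n) ↔ (Walk (T (suc i)) v n ⊎ Walk (B (suc (suc i))) v n)
  walk-B n i = mk↔ₛ′ to from (λ { (inj₁ w) → refl ; (inj₂ w) → refl })
                             (λ { (B→T .(suc i) ∷ w) → refl ; (B→B .(suc i) ∷ w) → refl })
    where
    to : Walk (B (suc i)) v (suc n) → Walk (T (suc i)) v n ⊎ Walk (B (suc (suc i))) v n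
    to (B→T .(suc i) ∷ w) = inj₁ w
    to (B→B .(suc i) ∷ w) = inj₂ w
    from : Walk (T (suc i)) v n ⊎ Walk (B (suc (suc i))) v n → Walk (B (suc i)) v (suc n)
    from (inj₁ w) = B→T (suc i) ∷ w
    from (inj₂ w) = B→B (suc i) ∷ w

  walk-zero : ∀ u → Walk u v 0 ↔ Fin (δ u v)
  walk-zero u with u ≟ᵥ v
  ... | yes refl = mk↔ₛ′ (λ _ → Fin.zero) (λ _ → []) (λ { Fin.zero → refl ; (Fin.suc ()) }) (λ { [] → refl })
  ... | no u≢v   = mk↔ₛ′ (λ { [] → ⊥-elim (u≢v refl) }) (λ ()) (λ ()) (λ { [] → ⊥-elim (u≢v refl) })

  walks↔Fin : height v ≤ 1 → ∀ n u → Walk u v n ↔ Fin (walks u v n)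
  walks↔Fin v-low zero    u           = walk-zero u
  walks↔Fin v-low (suc n) (T zero)    =
    ↔-trans (walk-T₀ n) (↔-trans (walks↔Fin v-low n (T 1) ⊎-↔ catastrophes) (↔-sym +↔⊎))
    where
    catastrophes = Σ-↔-sumℕ _ _ (λ j → walks↔Fin v-low n (T (suc (suc j)))) (suc n)
                              (λ j → unreachable v-low (beyond-catastrophe n j))
  walks↔Fin v-low (suc n) (T (suc i)) =
    ↔-trans (walk-T n i) (↔-trans (walks↔Fin v-low n (B i) ⊎-↔ walks↔Fin v-low n (T (suc (suc i)))) (↔-sym +↔⊎))
  walks↔Fin v-low (suc n) (B zero)    =
    ↔-trans (walk-B₀ n) (↔-trans (walks↔Fin v-low n (T 0) ⊎-↔
      ↔-trans (walks↔Fin v-low n (B 1) ⊎-↔ catastrophes) (↔-sym +↔⊎)) (↔-sym +↔⊎))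
    where
    catastrophes = Σ-↔-sumℕ _ _ (λ j → walks↔Fin v-low n (B (suc (suc j)))) (suc n)
                              (λ j → unreachable v-low (ℕ.m<n⇒m<1+n (beyond-catastrophe n j)))
  walks↔Fin v-low (suc n) (B (suc i)) =
    ↔-trans (walk-B n i) (↔-trans (walks↔Fin v-low n (T (suc i)) ⊎-↔ walks↔Fin v-low n (B (suc (suc i)))) (↔-sym +↔⊎))

count-zero : ∀ {A : Set} {c} → A ↔ Fin c → ¬ A → c ≡ 0
count-zero {c = zero}  _  _  = refl
count-zero {c = suc c} A↔ ¬A = ⊥-elim (¬A (Inverse.from A↔ Fin.zero))

counts-walks : ∀ {u v c} → height v ≤ 1 → CountsWalks u v c → ∀ n → c n ≡ walks u v n
counts-walks {u} v-low count n = ↔⇒≡ (↔-trans (↔-sym (count n)) (walks↔Fin v-low n u))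

up : Vertex → Vertex
up (T i) = B i
up (B i) = T (suc i)

vertexAt : ℕ → Vertex
vertexAt zero    = T 0
vertexAt (suc h) = up (vertexAt h)

height-up : ∀ u → height (up u) ≡ suc (height u)
height-up (T i) = refl
height-up (B i) = cong suc (ℕ.+-suc i i)

height-vertexAt : ∀ h → height (vertexAt h) ≡ h
height-vertexAt zero    = refl
height-vertexAt (suc h) = trans (height-up (vertexAt h)) (cong suc (height-vertexAt h))

vertexAt-height : ∀ u → vertexAt (height u) ≡ u
vertexAt-height (T i) = vertexAt-double i
  where
  vertexAt-double : ∀ i → vertexAt (i +ℕ i) ≡ T i
  vertexAt-double zero    = refl
  vertexAt-double (suc i) rewrite ℕ.+-suc i i | vertexAt-double i = refl
vertexAt-height (B i) = cong up (vertexAt-height (T i))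

walks-up-up : ∀ u v m → walks (up (up u)) v (suc m) ≡ walks (up u) v m +ℕ walks (up (up (up (up u)))) v m
walks-up-up (T i) v m = refl
walks-up-up (B i) v m = refl

module WalkSeries (v : Vertex) (v-low : height v ≤ 1) where

  W : Vertex → PS
  W u n = + walks u v n

  W-unreachable : ∀ u n → suc n < height u → W u n ≡ + 0
  W-unreachable u n n+1<h = cong +_ (count-zero (walks↔Fin v-low n u) (unreachable v-low n+1<h))

  X : ℕ → PS
  X h = W (vertexAt h)

  X-above : ∀ h → X (suc h) ≈ firstPassage h ⊛ X 1
  X-above = firstPassage-decomposition (λ h → X (suc h)) start step
    where
    start : ∀ h → X (suc (suc h)) 0 ≡ + 0
    start h = W-unreachable (vertexAt (suc (suc h))) 0
      (subst (1 <_) (sym (height-vertexAt (suc (suc h)))) (s≤s (s≤s z≤n)))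
    step : ∀ h m → X (suc (suc h)) (suc m) ≡ X (suc h) m +ℤ X (suc (3 +ℕ h)) m
    step h m = trans (cong +_ (walks-up-up (vertexAt h) v m)) (ℤ.pos-+ (walks (vertexAt (suc h)) v m) _)

  W-above : ∀ k h {u w} → height u ≡ suc h → height w ≡ k +ℕ suc h → W w ≈ firstPassage k ⊛ W u
  W-above k h {u} {w} hu hw = begin
    W w                                        ≈⟨ at-height w hw ⟩
    X (k +ℕ suc h)                             ≈⟨ at-index (ℕ.+-suc k h) ⟩
    X (suc (k +ℕ h))                           ≈⟨ X-above (k +ℕ h) ⟩
    firstPassage (k +ℕ h) ⊛ X 1                ≈⟨ ⊛-congʳ (X 1) (firstPassage-+ k h) ⟩
    firstPassage k ⊛ firstPassage h ⊛ X 1      ≈⟨ conv-assoc (firstPassage k) (firstPassage h) (X 1) ⟩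
    firstPassage k ⊛ (firstPassage h ⊛ X 1)    ≈⟨ ⊛-congˡ (firstPassage k) (≈-sym (X-above h)) ⟩
    firstPassage k ⊛ X (suc h)                 ≈⟨ ⊛-congˡ (firstPassage k) (≈-sym (at-height u hu)) ⟩
    firstPassage k ⊛ W u                       ∎
    where
    open ≈-Reasoning
    at-index : ∀ {h h′} → h ≡ h′ → X h ≈ X h′
    at-index refl = ≈-refl
    at-height : ∀ u {h} → height u ≡ h → W u ≈ X h
    at-height u refl n = cong (λ x → + walks x v n) (sym (vertexAt-height u))

  W-B : ∀ j → W (B (suc j)) ≈ D ⊛ W (T (suc j))
  W-B j = W-above 1 (j +ℕ suc j) refl refl

  W-T : ∀ j → W (T (suc (suc j))) ≈ D ⊛ D ⊛ W (T (suc j))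
  W-T j = ≈-trans (W-above 2 (j +ℕ suc j) refl (cong (suc ∘′ suc) (ℕ.+-suc j (suc j))))
                  (⊛-congʳ (W (T (suc j))) (firstPassage-+ 1 1))

  W-T₁ : W (T 1) ≈ D ⊛ W (B 0)
  W-T₁ = W-above 1 0 refl refl

  upper-T : ℕ → PS
  upper-T j = W (T (suc j))

  upper-B : ℕ → PS
  upper-B j = W (B (suc j))

  upper-T-summable : Summable upper-T
  upper-T-summable j m m<j = W-unreachable (T (suc j)) m (s≤s (ℕ.≤-trans m<j (ℕ.m≤m+n j (suc j))))

  upper-B-summable : Summable upper-B
  upper-B-summable j m m<j = W-unreachable (B (suc j)) m (s≤s (ℕ.m<n⇒m<1+n (ℕ.≤-trans m<j (ℕ.m≤m+n j (suc j)))))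

  A : PS
  A = Σ∞ upper-T

  T₀-equation : W (T 0) ≈ const (+ δ (T 0) v) ⊕ zs ⊛ A
  T₀-equation = by-first-step _ refl λ n → begin
    + (walks (T 1) v n +ℕ sumℕ (suc n) (λ j → walks (T (suc (suc j))) v n))
      ≡⟨ ℤ.pos-+ (walks (T 1) v n) _ ⟩
    W (T 1) n +ℤ + sumℕ (suc n) (λ j → walks (T (suc (suc j))) v n)
      ≡⟨ cong (W (T 1) n +ℤ_) (+-sumℕ (suc n) (λ j → walks (T (suc (suc j))) v n)) ⟩
    (upper-T 0 ⊕ Σ∞ (λ j → upper-T (suc j))) n
      ≡⟨ sym (Σ∞-split upper-T upper-T-summable n) ⟩
    A n ∎
    where open ≡-Reasoning

  B₀-equation : W (B 0) ≈ const (+ δ (B 0) v) ⊕ zs ⊛ (W (T 0) ⊕ D ⊛ A)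
  B₀-equation = by-first-step _ refl λ n → begin
    + (walks (T 0) v n +ℕ (walks (B 1) v n +ℕ sumℕ (suc n) (λ j → walks (B (suc (suc j))) v n)))
      ≡⟨ ℤ.pos-+ (walks (T 0) v n) _ ⟩
    W (T 0) n +ℤ + (walks (B 1) v n +ℕ sumℕ (suc n) (λ j → walks (B (suc (suc j))) v n))
      ≡⟨ cong (W (T 0) n +ℤ_) (ℤ.pos-+ (walks (B 1) v n) _) ⟩
    W (T 0) n +ℤ (W (B 1) n +ℤ + sumℕ (suc n) (λ j → walks (B (suc (suc j))) v n))
      ≡⟨ cong (λ x → W (T 0) n +ℤ (W (B 1) n +ℤ x)) (+-sumℕ (suc n) (λ j → walks (B (suc (suc j))) v n)) ⟩
    W (T 0) n +ℤ (upper-B 0 ⊕ Σ∞ (λ j → upper-B (suc j))) n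
      ≡⟨ cong (W (T 0) n +ℤ_) (sym (Σ∞-split upper-B upper-B-summable n)) ⟩
    W (T 0) n +ℤ Σ∞ upper-B n
      ≡⟨ cong (W (T 0) n +ℤ_) (Σ∞-cong W-B n) ⟩
    W (T 0) n +ℤ Σ∞ (λ j → D ⊛ upper-T j) n
      ≡⟨ cong (W (T 0) n +ℤ_) (sym (Σ∞-⊛ D upper-T upper-T-summable n)) ⟩
    (W (T 0) ⊕ D ⊛ A) n ∎
    where open ≡-Reasoning

  A-equation : A ≈ D ⊛ W (B 0) ⊕ D ⊛ D ⊛ A
  A-equation = begin
    A                                          ≈⟨ Σ∞-split upper-T upper-T-summable ⟩
    W (T 1) ⊕ Σ∞ (λ j → upper-T (suc j))       ≈⟨ ⊕-cong W-T₁ (Σ∞-cong W-T) ⟩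
    D ⊛ W (B 0) ⊕ Σ∞ (λ j → D ⊛ D ⊛ upper-T j) ≈⟨ ⊕-congˡ (D ⊛ W (B 0)) (≈-sym (Σ∞-⊛ (D ⊛ D) upper-T upper-T-summable)) ⟩
    D ⊛ W (B 0) ⊕ D ⊛ D ⊛ A                    ∎
    where open ≈-Reasoning

module _ {z d c₀ c₁ a b A : PS} (d₀≡0 : d 0 ≡ + 0) where

  private
    u : PS
    u = one ⊖ d ⊛ d

  -- Multiplying through by 1 − d² clears the geometric series in d² hidden in A.
  catastrophe-system :
    a ≈ c₀ ⊕ z ⊛ A → b ≈ c₁ ⊕ z ⊛ (a ⊕ d ⊛ A) → A ≈ d ⊛ b ⊕ d ⊛ d ⊛ A →
    (u ⊖ z ⊛ d ⊛ d ⊖ z ⊛ z ⊛ d) ⊛ a ≈ (u ⊖ z ⊛ d ⊛ d) ⊛ c₀ ⊕ z ⊛ d ⊛ c₁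
  catastrophe-system a-eq b-eq A-eq = ⊛-cancelˡ u₀≡1 (begin
    u ⊛ ((u ⊖ z ⊛ d ⊛ d ⊖ z ⊛ z ⊛ d) ⊛ a)
      ≈⟨ solve 4 (λ u z d a → u :* ((u :- z :* d :* d :- z :* z :* d) :* a)
                           := (u :- z :* d :* d) :* (u :* a) :- z :* z :* d :* (u :* a)) ≈-refl u z d a ⟩
    (u ⊖ z ⊛ d ⊛ d) ⊛ (u ⊛ a) ⊖ z ⊛ z ⊛ d ⊛ (u ⊛ a)
      ≈⟨ ⊖-congʳ (z ⊛ z ⊛ d ⊛ (u ⊛ a)) (⊛-congˡ (u ⊖ z ⊛ d ⊛ d) ua) ⟩
    (u ⊖ z ⊛ d ⊛ d) ⊛ (u ⊛ c₀ ⊕ z ⊛ (d ⊛ b)) ⊖ z ⊛ z ⊛ d ⊛ (u ⊛ a)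
      ≈⟨ solve 6 (λ u z d b c₀ ua → (u :- z :* d :* d) :* (u :* c₀ :+ z :* (d :* b)) :- z :* z :* d :* ua
                                 := u :* ((u :- z :* d :* d) :* c₀) :+ z :* d :* ((u :- z :* d :* d) :* b) :- z :* z :* d :* ua)
               ≈-refl u z d b c₀ (u ⊛ a) ⟩
    u ⊛ ((u ⊖ z ⊛ d ⊛ d) ⊛ c₀) ⊕ z ⊛ d ⊛ ((u ⊖ z ⊛ d ⊛ d) ⊛ b) ⊖ z ⊛ z ⊛ d ⊛ (u ⊛ a)
      ≈⟨ ⊖-congʳ (z ⊛ z ⊛ d ⊛ (u ⊛ a)) (⊕-congˡ (u ⊛ ((u ⊖ z ⊛ d ⊛ d) ⊛ c₀)) (⊛-congˡ (z ⊛ d) ub)) ⟩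
    u ⊛ ((u ⊖ z ⊛ d ⊛ d) ⊛ c₀) ⊕ z ⊛ d ⊛ (u ⊛ c₁ ⊕ z ⊛ (u ⊛ a)) ⊖ z ⊛ z ⊛ d ⊛ (u ⊛ a)
      ≈⟨ solve 6 (λ u z d c₀ c₁ ua → u :* ((u :- z :* d :* d) :* c₀) :+ z :* d :* (u :* c₁ :+ z :* ua) :- z :* z :* d :* ua
                                  := u :* ((u :- z :* d :* d) :* c₀ :+ z :* d :* c₁))
               ≈-refl u z d c₀ c₁ (u ⊛ a) ⟩
    u ⊛ ((u ⊖ z ⊛ d ⊛ d) ⊛ c₀ ⊕ z ⊛ d ⊛ c₁) ∎)
    where
    open ≈-Reasoning

    u₀≡1 : u 0 ≡ + 1
    u₀≡1 rewrite d₀≡0 = refl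

    uA : u ⊛ A ≈ d ⊛ b
    uA = begin
      u ⊛ A                                ≈⟨ solve 2 (λ d A → (con (+ 1) :- d :* d) :* A := A :- d :* d :* A) ≈-refl d A ⟩
      A ⊖ d ⊛ d ⊛ A                        ≈⟨ ⊖-congʳ (d ⊛ d ⊛ A) A-eq ⟩
      d ⊛ b ⊕ d ⊛ d ⊛ A ⊖ d ⊛ d ⊛ A        ≈⟨ solve 3 (λ d b A → d :* b :+ d :* d :* A :- d :* d :* A := d :* b) ≈-refl d b A ⟩
      d ⊛ b                                ∎

    ua : u ⊛ a ≈ u ⊛ c₀ ⊕ z ⊛ (d ⊛ b)
    ua = begin
      u ⊛ a                      ≈⟨ ⊛-congˡ u a-eq ⟩
      u ⊛ (c₀ ⊕ z ⊛ A)           ≈⟨ solve 4 (λ u c₀ z A → u :* (c₀ :+ z :* A) := u :* c₀ :+ z :* (u :* A)) ≈-refl u c₀ z A ⟩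
      u ⊛ c₀ ⊕ z ⊛ (u ⊛ A)       ≈⟨ ⊕-congˡ (u ⊛ c₀) (⊛-congˡ z uA) ⟩
      u ⊛ c₀ ⊕ z ⊛ (d ⊛ b)       ∎

    ub : (u ⊖ z ⊛ d ⊛ d) ⊛ b ≈ u ⊛ c₁ ⊕ z ⊛ (u ⊛ a)
    ub = begin
      (u ⊖ z ⊛ d ⊛ d) ⊛ b
        ≈⟨ solve 4 (λ u z d b → (u :- z :* d :* d) :* b := u :* b :- z :* d :* (d :* b)) ≈-refl u z d b ⟩
      u ⊛ b ⊖ z ⊛ d ⊛ (d ⊛ b)
        ≈⟨ ⊖-congʳ (z ⊛ d ⊛ (d ⊛ b)) (⊛-congˡ u b-eq) ⟩
      u ⊛ (c₁ ⊕ z ⊛ (a ⊕ d ⊛ A)) ⊖ z ⊛ d ⊛ (d ⊛ b)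
        ≈⟨ solve 7 (λ u z d a A b c₁ → u :* (c₁ :+ z :* (a :+ d :* A)) :- z :* d :* (d :* b)
                                    := u :* c₁ :+ z :* (u :* a) :+ z :* d :* (u :* A) :- z :* d :* (d :* b))
                 ≈-refl u z d a A b c₁ ⟩
      u ⊛ c₁ ⊕ z ⊛ (u ⊛ a) ⊕ z ⊛ d ⊛ (u ⊛ A) ⊖ z ⊛ d ⊛ (d ⊛ b)
        ≈⟨ ⊖-congʳ (z ⊛ d ⊛ (d ⊛ b)) (⊕-congˡ (u ⊛ c₁ ⊕ z ⊛ (u ⊛ a)) (⊛-congˡ (z ⊛ d) uA)) ⟩
      u ⊛ c₁ ⊕ z ⊛ (u ⊛ a) ⊕ z ⊛ d ⊛ (d ⊛ b) ⊖ z ⊛ d ⊛ (d ⊛ b)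
        ≈⟨ solve 4 (λ x y w d → x :+ y :+ w :* d :- w :* d := x :+ y) ≈-refl (u ⊛ c₁) (z ⊛ (u ⊛ a)) (z ⊛ d) (d ⊛ b) ⟩
      u ⊛ c₁ ⊕ z ⊛ (u ⊛ a)       ∎

cubic-unique : ∀ {t s} → t 0 ≡ + 0 → s 0 ≡ + 0 →
  t ⊛ (one ⊖ t) ⊛ (one ⊖ t) ≈ s ⊛ (one ⊖ s) ⊛ (one ⊖ s) → t ≈ s
cubic-unique {t} {s} t₀≡0 s₀≡0 same = ⊛-cancelˡ u₀≡1 (begin
  u ⊛ t
    ≈⟨ solve 2 (λ t s → (con (+ 1) :- con (+ 2) :* (t :+ s) :+ (t :* t :+ t :* s :+ s :* s)) :* t
                     := t :* (con (+ 1) :- t) :* (con (+ 1) :- t)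
                        :+ ((con (+ 1) :- con (+ 2) :* (t :+ s) :+ (t :* t :+ t :* s :+ s :* s)) :* s
                            :- s :* (con (+ 1) :- s) :* (con (+ 1) :- s))) ≈-refl t s ⟩
  t ⊛ (one ⊖ t) ⊛ (one ⊖ t) ⊕ (u ⊛ s ⊖ s ⊛ (one ⊖ s) ⊛ (one ⊖ s))
    ≈⟨ ⊕-congʳ (u ⊛ s ⊖ s ⊛ (one ⊖ s) ⊛ (one ⊖ s)) same ⟩
  s ⊛ (one ⊖ s) ⊛ (one ⊖ s) ⊕ (u ⊛ s ⊖ s ⊛ (one ⊖ s) ⊛ (one ⊖ s))
    ≈⟨ solve 2 (λ x y → x :+ (y :- x) := y) ≈-refl (s ⊛ (one ⊖ s) ⊛ (one ⊖ s)) (u ⊛ s) ⟩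
  u ⊛ s ∎)
  where
  open ≈-Reasoning
  -- t(1−t)² − s(1−s)² = (t − s) u
  u : PS
  u = one ⊖ const (+ 2) ⊛ (t ⊕ s) ⊕ (t ⊛ t ⊕ t ⊛ s ⊕ s ⊛ s)
  u₀≡1 : u 0 ≡ + 1
  u₀≡1 rewrite t₀≡0 | s₀≡0 = refl

D-minus-zD³ : D ⊖ zs ⊛ D ⊛ D ⊛ D ≈ zs
D-minus-zD³ = begin
  D ⊖ zs ⊛ D ⊛ D ⊛ D                          ≈⟨ ⊖-congʳ (zs ⊛ D ⊛ D ⊛ D) D-equation ⟩
  zs ⊛ (one ⊕ D ⊛ D ⊛ D) ⊖ zs ⊛ D ⊛ D ⊛ D     ≈⟨ solve 2 (λ z D → z :* (con (+ 1) :+ D :* D :* D) :- z :* D :* D :* D := z) ≈-refl zs D ⟩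
  zs                                          ∎
  where open ≈-Reasoning

-- By cubic-unique, this is the series t of the theorem.
τ : PS
τ = zs ⊛ D ⊛ D

τ-cubic : τ ⊛ (one ⊖ τ) ⊛ (one ⊖ τ) ≈ zs ⊛ zs ⊛ zs
τ-cubic = begin
  τ ⊛ (one ⊖ τ) ⊛ (one ⊖ τ)
    ≈⟨ solve 2 (λ z D → z :* D :* D :* (con (+ 1) :- z :* D :* D) :* (con (+ 1) :- z :* D :* D)
                     := z :* ((D :- z :* D :* D :* D) :* (D :- z :* D :* D :* D))) ≈-refl zs D ⟩
  zs ⊛ ((D ⊖ zs ⊛ D ⊛ D ⊛ D) ⊛ (D ⊖ zs ⊛ D ⊛ D ⊛ D))
    ≈⟨ ⊛-congˡ zs (⊛-cong D-minus-zD³ D-minus-zD³) ⟩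
  zs ⊛ (zs ⊛ zs)
    ≈⟨ ≈-sym (conv-assoc zs zs zs) ⟩
  zs ⊛ zs ⊛ zs ∎
  where open ≈-Reasoning

denominator : PS → PS
denominator t = zs ⊖ t ⊖ const (+ 2) ⊛ zs ⊛ t ⊕ zs ⊛ t ⊛ t

denominator-cong : ∀ {t t′} → t ≈ t′ → denominator t ≈ denominator t′
denominator-cong t≈ = ⊕-cong (⊕-cong (⊕-congˡ zs (⊝-cong t≈)) (⊝-cong (⊛-congˡ (const (+ 2) ⊛ zs) t≈)))
                             (⊛-cong (⊛-congˡ zs t≈) t≈)

kernel : PS
kernel = one ⊖ D ⊛ D ⊖ zs ⊛ D ⊛ D ⊖ zs ⊛ zs ⊛ D

denominator-τ : denominator τ ≈ zs ⊛ kernel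
denominator-τ = begin
  denominator τ
    ≈⟨ solve 2 (λ z D → z :- z :* D :* D :- con (+ 2) :* z :* (z :* D :* D) :+ z :* (z :* D :* D) :* (z :* D :* D)
                     := z :* (con (+ 1) :- D :* D :- z :* D :* D :- z :* z :* D) :+ z :* z :* D :* (z :- (D :- z :* D :* D :* D)))
               ≈-refl zs D ⟩
  zs ⊛ kernel ⊕ zs ⊛ zs ⊛ D ⊛ (zs ⊖ (D ⊖ zs ⊛ D ⊛ D ⊛ D))
    ≈⟨ ⊕-congˡ (zs ⊛ kernel) (⊛-congˡ (zs ⊛ zs ⊛ D) (⊕-congˡ zs (⊝-cong D-minus-zD³))) ⟩
  zs ⊛ kernel ⊕ zs ⊛ zs ⊛ D ⊛ (zs ⊖ zs)
    ≈⟨ solve 3 (λ z D x → x :+ z :* z :* D :* (z :- z) := x) ≈-refl zs D (zs ⊛ kernel) ⟩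
  zs ⊛ kernel ∎
  where open ≈-Reasoning

module _ (v : Vertex) (v-low : height v ≤ 1) where
  open WalkSeries v v-low

  walks-from-T₀ : fromℕ (λ n → walks (T 0) v n) ⊛ denominator τ ≈
                  zs ⊛ ((one ⊖ D ⊛ D ⊖ zs ⊛ D ⊛ D) ⊛ const (+ δ (T 0) v) ⊕ zs ⊛ D ⊛ const (+ δ (B 0) v))
  walks-from-T₀ = begin
    W (T 0) ⊛ denominator τ  ≈⟨ ⊛-congˡ (W (T 0)) denominator-τ ⟩
    W (T 0) ⊛ (zs ⊛ kernel)  ≈⟨ solve 3 (λ a z K → a :* (z :* K) := z :* (K :* a)) ≈-refl (W (T 0)) zs kernel ⟩
    zs ⊛ (kernel ⊛ W (T 0))  ≈⟨ ⊛-congˡ zs (catastrophe-system refl T₀-equation B₀-equation A-equation) ⟩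
    zs ⊛ ((one ⊖ D ⊛ D ⊖ zs ⊛ D ⊛ D) ⊛ const (+ δ (T 0) v) ⊕ zs ⊛ D ⊛ const (+ δ (B 0) v)) ∎
    where open ≈-Reasoning

walks-T₀-T₀ : fromℕ (λ n → walks (T 0) (T 0) n) ⊛ denominator τ ≈ zs ⊖ τ ⊖ zs ⊛ τ
walks-T₀-T₀ = ≈-trans (walks-from-T₀ (T 0) z≤n)
  (solve 2 (λ z D → z :* ((con (+ 1) :- D :* D :- z :* D :* D) :* con (+ 1) :+ z :* D :* con (+ 0))
                 := z :- z :* D :* D :- z :* (z :* D :* D)) ≈-refl zs D)

walks-T₀-B₀ : fromℕ (λ n → walks (T 0) (B 0) n) ⊛ denominator τ ≈ τ ⊛ (one ⊖ τ)
walks-T₀-B₀ = begin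
  fromℕ (λ n → walks (T 0) (B 0) n) ⊛ denominator τ
    ≈⟨ walks-from-T₀ (B 0) ℕ.≤-refl ⟩
  zs ⊛ ((one ⊖ D ⊛ D ⊖ zs ⊛ D ⊛ D) ⊛ 0ₚ ⊕ zs ⊛ D ⊛ one)
    ≈⟨ solve 2 (λ z D → z :* ((con (+ 1) :- D :* D :- z :* D :* D) :* con (+ 0) :+ z :* D :* con (+ 1)) := z :* D :* z)
             ≈-refl zs D ⟩
  zs ⊛ D ⊛ zs                        ≈⟨ ⊛-congˡ (zs ⊛ D) (≈-sym D-minus-zD³) ⟩
  zs ⊛ D ⊛ (D ⊖ zs ⊛ D ⊛ D ⊛ D)
    ≈⟨ solve 2 (λ z D → z :* D :* (D :- z :* D :* D :* D) := z :* D :* D :* (con (+ 1) :- z :* D :* D)) ≈-refl zs D ⟩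
  τ ⊛ (one ⊖ τ)                      ∎
  where open ≈-Reasoning

mainTheorem4 :
    (t : PS) → t 0 ≡ + 0 → t ⊛ (one ⊖ t) ⊛ (one ⊖ t) ≈ zs ⊛ zs ⊛ zs →
    (a₀ b₀ : ℕ → ℕ) → CountsWalks (T 0) (T 0) a₀ → CountsWalks (T 0) (B 0) b₀ →
    (fromℕ b₀ ⊛ (zs ⊖ t ⊖ const (+ 2) ⊛ zs ⊛ t ⊕ zs ⊛ t ⊛ t) ≈ t ⊛ (one ⊖ t))
    × (fromℕ a₀ ⊛ (zs ⊖ t ⊖ const (+ 2) ⊛ zs ⊛ t ⊕ zs ⊛ t ⊛ t) ≈ zs ⊖ t ⊖ zs ⊛ t)
mainTheorem4 t t₀≡0 t-cubic a₀ b₀ count-a count-b =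
  (begin
    fromℕ b₀ ⊛ denominator t                           ≈⟨ ⊛-cong b₀≈ (denominator-cong t≈τ) ⟩
    fromℕ (λ n → walks (T 0) (B 0) n) ⊛ denominator τ  ≈⟨ walks-T₀-B₀ ⟩
    τ ⊛ (one ⊖ τ)                                      ≈⟨ ≈-sym (⊛-cong t≈τ (⊕-congˡ one (⊝-cong t≈τ))) ⟩
    t ⊛ (one ⊖ t)                                      ∎) ,
  (begin
    fromℕ a₀ ⊛ denominator t                           ≈⟨ ⊛-cong a₀≈ (denominator-cong t≈τ) ⟩
    fromℕ (λ n → walks (T 0) (T 0) n) ⊛ denominator τ  ≈⟨ walks-T₀-T₀ ⟩
    zs ⊖ τ ⊖ zs ⊛ τ                                    ≈⟨ ≈-sym (⊕-cong (⊕-congˡ zs (⊝-cong t≈τ)) (⊝-cong (⊛-congˡ zs t≈τ))) ⟩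
    zs ⊖ t ⊖ zs ⊛ t                                    ∎)
  where
  open ≈-Reasoning
  t≈τ : t ≈ τ
  t≈τ = cubic-unique t₀≡0 refl (≈-trans t-cubic (≈-sym τ-cubic))
  a₀≈ : fromℕ a₀ ≈ fromℕ (λ n → walks (T 0) (T 0) n)
  a₀≈ n = cong +_ (counts-walks z≤n count-a n)
  b₀≈ : fromℕ b₀ ≈ fromℕ (λ n → walks (T 0) (B 0) n)
  b₀≈ n = cong +_ (counts-walks ℕ.≤-refl count-b n)
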